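{- Let $G=(V,E)$ be a graph, $u,v\in V$ distinct, and let $\mathcal{H}=\{H_1,\dots,H_k\}$ be a $uv$-compatible family in $G$. (a) If $|H_i\cap H_j|\ge3$ for some pair $1\le i<j\le k$, then there is a $uv$-compatible family $\mathcal{H}'$ with $\mathrm{cov}(\mathcal{H})\subseteq\mathrm{cov}(\mathcal{H}')$ and $\mathrm{val}(\mathcal{H}')<\mathrm{val}(\mathcal{H})$. (b) If $G$ is $uv$-sparse and $\mathcal{H}$ is tight, then $H_i\cap H_j=\{u,v\}$ for all $1\le i<j\le k$.
   Context: Graphs are finite and simple. $i(X)$ counts edges with both ends in $X\subseteq V$; for a family $\mathcal{S}=\{S_1,\dots,S_k\}$, $i(\mathcal{S})$ counts edges with both ends in some $S_j$ and $\mathrm{cov}(\mathcal{S})=\{(x,y):x,y\in V,\{x,y\}\subseteq S_j\text{ for some }j\}$. For nonempty $H\subseteq V$, $\mathrm{val}(H)=2|H|-t_H$ with $t_H=4$ if $H=\{u,v\}$, $t_H=3$ if $H\ne\{u,v\}$ and $|H|\in\{2,3\}$, $t_H=2$ otherwise. $\mathcal{H}$ is $uv$-compatible if $u,v\in H_j$ and $|H_j|\ge3$ for all $j$; $\mathrm{val}(\mathcal{H})=\sum_j\mathrm{val}(H_j)-2(k-1)$. $G$ is $uv$-sparse if $i(H)\le\mathrm{val}(H)$ for all $H\subseteq V$ with $|H|\ge2$ and $i(\mathcal{H})\le\mathrm{val}(\mathcal{H})$ for all $uv$-compatible $\mathcal{H}$; $\mathcal{H}$ is tight if $i(\mathcal{H})=\mathrm{val}(\mathcal{H})$.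 -}

module Defs where

open import Data.Bool using (Bool; true; false; _∧_; if_then_else_)
import Data.Bool.Properties as BoolP
open import Data.Nat as ℕ using (ℕ; zero; suc; _<ᵇ_)
open import Data.Integer as ℤ using (ℤ; +_)
open import Data.Fin using (Fin; toℕ)
open import Data.Fin.Subset using (Subset; _∈_; ⁅_⁆; _∪_; _∩_; ∣_∣)
open import Data.Vec using (lookup)
open import Data.Vec.Properties using (≡-dec)
open import Data.List as List using (List; length; allFin; map; foldr)
open import Data.Nat.ListAction using (sum)
open import Data.Bool.ListAction using (any)
open import Data.List.Relation.Unary.All using (All)
open import Data.List.Relation.Unary.Any using (Any)
open import Data.Product using (_×_)
open import Relation.Binary.PropositionalEquality using (_≡_)
open import Relation.Nullary using (yes; no)

record Graph (n : ℕ) : Set where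
  field
    adj    : Fin n → Fin n → Bool
    sym    : ∀ x y → adj x y ≡ adj y x
    irrefl : ∀ x → adj x x ≡ false
open Graph public

-- number of unordered pairs {x,y} (x ≠ y, counted once via toℕ x < toℕ y) satisfying P
pairCount : {n : ℕ} → (Fin n → Fin n → Bool) → ℕ
pairCount {n} P =
  sum (map (λ x → sum (map (λ y →
    if (toℕ x <ᵇ toℕ y) ∧ P x y then 1 else 0) (allFin n))) (allFin n))

iSet : {n : ℕ} → Graph n → Subset n → ℕ
iSet G X = pairCount (λ x y → adj G x y ∧ lookup X x ∧ lookup X y)

covB : {n : ℕ} → List (Subset n) → Fin n → Fin n → Bool
covB F x y = any (λ S → lookup S x ∧ lookup S y) F

iFam : {n : ℕ} → Graph n → List (Subset n) → ℕ
iFam G F = pairCount (λ x y → adj G x y ∧ covB F x y)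

Cov : {n : ℕ} → List (Subset n) → Fin n → Fin n → Set
Cov F x y = Any (λ S → x ∈ S × y ∈ S) F

tH : {n : ℕ} → Fin n → Fin n → Subset n → ℤ
tH u v H with ≡-dec BoolP._≟_ H (⁅ u ⁆ ∪ ⁅ v ⁆)
... | yes _ = + 4
... | no _ with ∣ H ∣
...   | 2 = + 3
...   | 3 = + 3
...   | _ = + 2

val : {n : ℕ} → Fin n → Fin n → Subset n → ℤ
val u v H = (+ 2) ℤ.* (+ ∣ H ∣) ℤ.- tH u v H

valFam : {n : ℕ} → Fin n → Fin n → List (Subset n) → ℤ
valFam u v F =
  foldr ℤ._+_ (+ 0) (map (val u v) F) ℤ.- (+ 2) ℤ.* ((+ length F) ℤ.- (+ 1))

Compatible : {n : ℕ} → Fin n → Fin n → List (Subset n) → Set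
Compatible u v F = 1 ℕ.≤ length F × All (λ H → u ∈ H × v ∈ H × 3 ℕ.≤ ∣ H ∣) F

Sparse : {n : ℕ} → Graph n → Fin n → Fin n → Set
Sparse {n} G u v =
  (∀ (H : Subset n) → 2 ℕ.≤ ∣ H ∣ → (+ iSet G H) ℤ.≤ val u v H) ×
  (∀ (F : List (Subset n)) → Compatible u v F → (+ iFam G F) ℤ.≤ valFam u v F)

Tight : {n : ℕ} → Graph n → Fin n → Fin n → List (Subset n) → Set
Tight G u v F = (+ iFam G F) ≡ valFam u v F

-- Merging two members A, B of a compatible family into A ∪ B keeps every covered pair covered
-- and changes val by 2 − 2|A ∩ B| + t_A + t_B − t_{A∪B}, which is negative once |A ∩ B| ≥ 3:
-- t only takes the values 2 and 3, and t_A = t_B = 3 with |A ∩ B| = 3 forces A = B = A ∪ B.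
-- For (b): the merged family covers at least as many edges, so by sparsity its value is at
-- least i(𝓗) = val(𝓗), contradicting the decrease; hence |H_i ∩ H_j| ≤ 2, and as the
-- intersection contains the two vertices u ≠ v it is exactly {u, v}.
module Submission where

open import Defs
open import Data.Nat using (ℕ; _≤_) renaming (_<_ to _<ℕ_)
open import Data.Integer using (_<_)
open import Data.Fin using (Fin; toℕ)
open import Data.Fin.Subset using (Subset; _∩_; _∪_; ⁅_⁆; ∣_∣)
open import Data.List using (List; length; lookup)
open import Data.Product using (_×_; Σ; ∃₂)
open import Relation.Binary.PropositionalEquality using (_≡_; _≢_)

open import Data.Bool using (Bool; true; false; _∧_; if_then_else_)
import Data.Bool.Properties as BoolP
open import Data.Nat as ℕ using (suc; z≤n; s≤s; _≟_; _≤?_)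
import Data.Nat.Properties as ℕP
open import Data.Nat.ListAction using (sum)
open import Data.Integer as ℤ using (ℤ; +_; +≤+)
import Data.Integer.Properties as ℤP
open import Data.Integer.Tactic.RingSolver using (solve-∀)
open import Data.Fin using (zero; suc)
open import Data.Fin.Subset using (_∈_; _⊆_)
import Data.Fin.Subset.Properties as SubsetP
open import Data.Vec as Vec using ([]; _∷_)
open import Data.Vec.Properties using (≡-dec; []=⇒lookup; lookup⇒[]=)
open import Data.List using ([]; _∷_; map; foldr; allFin)
open import Data.List.Relation.Unary.All using (_∷_)
open import Data.List.Relation.Unary.Any using (here; there)
open import Data.List.Relation.Binary.Permutation.Propositional
  using (_↭_) renaming (refl to ↭-refl; prep to ↭-prep; swap to ↭-swap; trans to ↭-trans)
open import Data.List.Relation.Binary.Permutation.Propositional.Properties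
  using (All-resp-↭; Any-resp-↭)
open import Data.Product using (_,_; proj₂)
open import Data.Sum using (inj₁; inj₂)
open import Data.Empty using (⊥-elim)
open import Function using (_∘_)
open import Relation.Binary.PropositionalEquality
  using (refl; trans; cong; cong₂; subst; subst₂; module ≡-Reasoning)
  renaming (sym to ≡-sym)
open import Relation.Nullary using (yes; no)

∣p∪q∣+∣p∩q∣≡∣p∣+∣q∣ : ∀ {n} (p q : Subset n) → ∣ p ∪ q ∣ ℕ.+ ∣ p ∩ q ∣ ≡ ∣ p ∣ ℕ.+ ∣ q ∣
∣p∪q∣+∣p∩q∣≡∣p∣+∣q∣ [] [] = refl
∣p∪q∣+∣p∩q∣≡∣p∣+∣q∣ (true ∷ p) (true ∷ q) = cong suc (begin
  ∣ p ∪ q ∣ ℕ.+ suc ∣ p ∩ q ∣ ≡⟨ ℕP.+-suc ∣ p ∪ q ∣ ∣ p ∩ q ∣ ⟩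
  suc (∣ p ∪ q ∣ ℕ.+ ∣ p ∩ q ∣) ≡⟨ cong suc (∣p∪q∣+∣p∩q∣≡∣p∣+∣q∣ p q) ⟩
  suc (∣ p ∣ ℕ.+ ∣ q ∣) ≡⟨ ℕP.+-suc ∣ p ∣ ∣ q ∣ ⟨
  ∣ p ∣ ℕ.+ suc ∣ q ∣ ∎)
  where open ≡-Reasoning
∣p∪q∣+∣p∩q∣≡∣p∣+∣q∣ (true ∷ p) (false ∷ q) = cong suc (∣p∪q∣+∣p∩q∣≡∣p∣+∣q∣ p q)
∣p∪q∣+∣p∩q∣≡∣p∣+∣q∣ (false ∷ p) (true ∷ q) =
  trans (cong suc (∣p∪q∣+∣p∩q∣≡∣p∣+∣q∣ p q)) (≡-sym (ℕP.+-suc ∣ p ∣ ∣ q ∣))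
∣p∪q∣+∣p∩q∣≡∣p∣+∣q∣ (false ∷ p) (false ∷ q) = ∣p∪q∣+∣p∩q∣≡∣p∣+∣q∣ p q

x∈p⇒0<∣p∣ : ∀ {n} {p : Subset n} {x} → x ∈ p → 0 <ℕ ∣ p ∣
x∈p⇒0<∣p∣ Vec.here = s≤s z≤n
x∈p⇒0<∣p∣ {p = s ∷ p} (Vec.there x∈p) = ℕP.≤-trans (x∈p⇒0<∣p∣ x∈p) (SubsetP.∣p∣≤∣x∷p∣ s p)

x≢y⇒1<∣p∣ : ∀ {n} {p : Subset n} {x y} → x ≢ y → x ∈ p → y ∈ p → 1 <ℕ ∣ p ∣
x≢y⇒1<∣p∣ x≢y x∈p y∈p = ℕP.≤-trans
  (s≤s (x∈p⇒0<∣p∣ (SubsetP.x∈p∧x≢y⇒x∈p-y y∈p (x≢y ∘ ≡-sym))))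
  (SubsetP.x∈p⇒∣p-x∣<∣p∣ x∈p)

∣⁅x⁆∪⁅y⁆∣≤2 : ∀ {n} (x y : Fin n) → ∣ ⁅ x ⁆ ∪ ⁅ y ⁆ ∣ ≤ 2
∣⁅x⁆∪⁅y⁆∣≤2 x y = subst (∣ ⁅ x ⁆ ∪ ⁅ y ⁆ ∣ ≤_)
  (trans (∣p∪q∣+∣p∩q∣≡∣p∣+∣q∣ ⁅ x ⁆ ⁅ y ⁆) (cong₂ ℕ._+_ (SubsetP.∣⁅x⁆∣≡1 x) (SubsetP.∣⁅x⁆∣≡1 y)))
  (ℕP.m≤m+n _ _)

p⊆q∧∣q∣≤∣p∣⇒p≡q : ∀ {n} {p q : Subset n} → p ⊆ q → ∣ q ∣ ≤ ∣ p ∣ → p ≡ q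
p⊆q∧∣q∣≤∣p∣⇒p≡q {p = p} {q} p⊆q ∣q∣≤∣p∣ = SubsetP.⊆-antisym p⊆q q⊆p
  where
  q⊆p : q ⊆ p
  q⊆p {x} x∈q with x SubsetP.∈? p
  ... | yes x∈p = x∈p
  ... | no x∉p = ⊥-elim (ℕP.<⇒≱ (SubsetP.p⊂q⇒∣p∣<∣q∣ (p⊆q , x , x∈q , x∉p)) ∣q∣≤∣p∣)

lookup-↭ : ∀ {A : Set} (F : List A) (j : Fin (length F)) → Σ (List A) λ R → F ↭ lookup F j ∷ R
lookup-↭ (H ∷ F) zero = F , ↭-refl
lookup-↭ (H ∷ F) (suc j) with lookup-↭ F j
... | R , F↭ = H ∷ R , ↭-trans (↭-prep H F↭) (↭-swap H (lookup F j) ↭-refl)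

lookup₂-↭ : ∀ {A : Set} (F : List A) (i j : Fin (length F)) → toℕ i <ℕ toℕ j →
  Σ (List A) λ R → F ↭ lookup F i ∷ lookup F j ∷ R
lookup₂-↭ (H ∷ F) zero (suc j) _ with lookup-↭ F j
... | R , F↭ = R , ↭-prep H F↭
lookup₂-↭ (H ∷ F) (suc i) (suc j) (s≤s i<j) with lookup₂-↭ F i j i<j
... | R , F↭ = H ∷ R , ↭-trans (↭-prep H F↭)
  (↭-trans (↭-swap H (lookup F i) ↭-refl) (↭-prep (lookup F i) (↭-swap H (lookup F j) ↭-refl)))

-- t_H as a function of |H|; it agrees with tH only when |H| ≥ 3, where H ≠ {u, v}.
tOfSize : ℕ → ℕ
tOfSize 3 = 3
tOfSize _ = 2

tOfSize≤3 : ∀ s → tOfSize s ≤ 3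
tOfSize≤3 0 = ℕP.n≤1+n 2
tOfSize≤3 1 = ℕP.n≤1+n 2
tOfSize≤3 2 = ℕP.n≤1+n 2
tOfSize≤3 3 = ℕP.≤-refl
tOfSize≤3 (suc (suc (suc (suc s)))) = ℕP.n≤1+n 2

2≤tOfSize : ∀ s → 2 ≤ tOfSize s
2≤tOfSize 0 = ℕP.≤-refl
2≤tOfSize 1 = ℕP.≤-refl
2≤tOfSize 2 = ℕP.≤-refl
2≤tOfSize 3 = ℕP.n≤1+n 2
2≤tOfSize (suc (suc (suc (suc s)))) = ℕP.≤-refl

s≢3⇒tOfSize≡2 : ∀ s → s ≢ 3 → tOfSize s ≡ 2
s≢3⇒tOfSize≡2 0 _ = refl
s≢3⇒tOfSize≡2 1 _ = refl
s≢3⇒tOfSize≡2 2 _ = refl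
s≢3⇒tOfSize≡2 3 s≢3 = ⊥-elim (s≢3 refl)
s≢3⇒tOfSize≡2 (suc (suc (suc (suc s)))) _ = refl

tH≡tOfSize : ∀ {n} (u v : Fin n) (H : Subset n) → 3 ≤ ∣ H ∣ → tH u v H ≡ + tOfSize (∣ H ∣)
tH≡tOfSize u v H 3≤∣H∣ with ≡-dec BoolP._≟_ H (⁅ u ⁆ ∪ ⁅ v ⁆)
... | yes refl = ⊥-elim (ℕP.<⇒≱ 3≤∣H∣ (∣⁅x⁆∪⁅y⁆∣≤2 u v))
... | no _ with ∣ H ∣ | 3≤∣H∣
...   | 3 | _ = refl
...   | suc (suc (suc (suc _))) | _ = refl
...   | 0 | ()
...   | 1 | s≤s ()
...   | 2 | s≤s (s≤s ())

val≡ : ∀ {n} (u v : Fin n) (H : Subset n) → 3 ≤ ∣ H ∣ →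
  val u v H ≡ + 2 ℤ.* + (∣ H ∣) ℤ.- + tOfSize (∣ H ∣)
val≡ u v H 3≤∣H∣ = cong (λ t → + 2 ℤ.* + (∣ H ∣) ℤ.- t) (tH≡tOfSize u v H 3≤∣H∣)

tOfSize-merge : ∀ {a b c U} → 3 ≤ c → U ℕ.+ c ≡ a ℕ.+ b →
  tOfSize a ℕ.+ tOfSize b ℕ.+ 3 ≤ 2 ℕ.* c ℕ.+ tOfSize U
tOfSize-merge {a} {b} {c} {U} 3≤c U+c≡a+b with c ≟ 3
... | no c≢3 = begin
  tOfSize a ℕ.+ tOfSize b ℕ.+ 3 ≤⟨ ℕP.+-monoˡ-≤ 3 (ℕP.+-mono-≤ (tOfSize≤3 a) (tOfSize≤3 b)) ⟩
  9                             <⟨ ℕP.n<1+n 9 ⟩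
  2 ℕ.* 4 ℕ.+ 2                 ≤⟨ ℕP.+-mono-≤ (ℕP.*-monoʳ-≤ 2 (ℕP.≤∧≢⇒< 3≤c (c≢3 ∘ ≡-sym))) (2≤tOfSize U) ⟩
  2 ℕ.* c ℕ.+ tOfSize U         ∎
  where open ℕP.≤-Reasoning
... | yes refl with a ≟ 3 | b ≟ 3
...   | yes refl | yes refl rewrite ℕP.+-cancelʳ-≡ 3 U 3 U+c≡a+b = ℕP.≤-refl
...   | no a≢3 | _ rewrite s≢3⇒tOfSize≡2 a a≢3 =
        ℕP.≤-trans (ℕP.+-monoˡ-≤ 3 (ℕP.+-monoʳ-≤ 2 (tOfSize≤3 b))) (ℕP.+-monoʳ-≤ 6 (2≤tOfSize U))
...   | yes refl | no b≢3 rewrite s≢3⇒tOfSize≡2 b b≢3 = ℕP.+-monoʳ-≤ 6 (2≤tOfSize U)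

val-merge-arith : ∀ (a b c U ta tb tU : ℤ) → U ℤ.+ c ≡ a ℤ.+ b →
  ta ℤ.+ tb ℤ.+ + 3 ℤ.≤ + 2 ℤ.* c ℤ.+ tU →
  (+ 2 ℤ.* U ℤ.- tU) ℤ.+ + 2 < (+ 2 ℤ.* a ℤ.- ta) ℤ.+ (+ 2 ℤ.* b ℤ.- tb)
val-merge-arith a b c U ta tb tU U+c≡a+b t-bound = ℤP.suc[i]≤j⇒i<j (begin
  + 1 ℤ.+ ((+ 2 ℤ.* U ℤ.- tU) ℤ.+ + 2)                ≡⟨ regroup U c tU ⟩
  + 2 ℤ.* (U ℤ.+ c) ℤ.- (+ 2 ℤ.* c ℤ.+ tU) ℤ.+ + 3    ≤⟨ ℤP.+-monoˡ-≤ (+ 3)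
                                                          (ℤP.+-monoʳ-≤ (+ 2 ℤ.* (U ℤ.+ c)) (ℤP.neg-mono-≤ t-bound)) ⟩
  + 2 ℤ.* (U ℤ.+ c) ℤ.- (ta ℤ.+ tb ℤ.+ + 3) ℤ.+ + 3   ≡⟨ cong (λ s → + 2 ℤ.* s ℤ.- (ta ℤ.+ tb ℤ.+ + 3) ℤ.+ + 3) U+c≡a+b ⟩
  + 2 ℤ.* (a ℤ.+ b) ℤ.- (ta ℤ.+ tb ℤ.+ + 3) ℤ.+ + 3   ≡⟨ split a b ta tb ⟩
  (+ 2 ℤ.* a ℤ.- ta) ℤ.+ (+ 2 ℤ.* b ℤ.- tb)           ∎)
  where
  open ℤP.≤-Reasoning
  regroup : ∀ x y z → + 1 ℤ.+ ((+ 2 ℤ.* x ℤ.- z) ℤ.+ + 2) ≡ + 2 ℤ.* (x ℤ.+ y) ℤ.- (+ 2 ℤ.* y ℤ.+ z) ℤ.+ + 3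
  regroup = solve-∀
  split : ∀ x y s t → + 2 ℤ.* (x ℤ.+ y) ℤ.- (s ℤ.+ t ℤ.+ + 3) ℤ.+ + 3 ≡ (+ 2 ℤ.* x ℤ.- s) ℤ.+ (+ 2 ℤ.* y ℤ.- t)
  split = solve-∀

val-∪+2<val+val : ∀ {n} (u v : Fin n) (A B : Subset n) → 3 ≤ ∣ A ∩ B ∣ →
  val u v (A ∪ B) ℤ.+ + 2 < val u v A ℤ.+ val u v B
val-∪+2<val+val u v A B 3≤∣A∩B∣ =
  subst₂ _<_ (cong (ℤ._+ + 2) (≡-sym (val≡ u v (A ∪ B) 3≤∣A∪B∣)))
             (≡-sym (cong₂ ℤ._+_ (val≡ u v A 3≤∣A∣) (val≡ u v B 3≤∣B∣)))
    (val-merge-arith (+ ∣ A ∣) (+ ∣ B ∣) (+ ∣ A ∩ B ∣) (+ ∣ A ∪ B ∣)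
      (+ tOfSize (∣ A ∣)) (+ tOfSize (∣ B ∣)) (+ tOfSize (∣ A ∪ B ∣)) sizes t-bound)
  where
  3≤∣A∣ : 3 ≤ ∣ A ∣
  3≤∣A∣ = ℕP.≤-trans 3≤∣A∩B∣ (SubsetP.∣p∩q∣≤∣p∣ A B)
  3≤∣B∣ : 3 ≤ ∣ B ∣
  3≤∣B∣ = ℕP.≤-trans 3≤∣A∩B∣ (SubsetP.∣p∩q∣≤∣q∣ A B)
  3≤∣A∪B∣ : 3 ≤ ∣ A ∪ B ∣
  3≤∣A∪B∣ = ℕP.≤-trans 3≤∣A∣ (SubsetP.∣p∣≤∣p∪q∣ A B)
  sizes : + ∣ A ∪ B ∣ ℤ.+ + ∣ A ∩ B ∣ ≡ + ∣ A ∣ ℤ.+ + ∣ B ∣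
  sizes = trans (≡-sym (ℤP.pos-+ ∣ A ∪ B ∣ ∣ A ∩ B ∣))
    (trans (cong +_ (∣p∪q∣+∣p∩q∣≡∣p∣+∣q∣ A B)) (ℤP.pos-+ ∣ A ∣ ∣ B ∣))
  t-bound : + tOfSize (∣ A ∣) ℤ.+ + tOfSize (∣ B ∣) ℤ.+ + 3 ℤ.≤ + 2 ℤ.* + ∣ A ∩ B ∣ ℤ.+ + tOfSize (∣ A ∪ B ∣)
  t-bound = subst₂ ℤ._≤_
    (trans (ℤP.pos-+ (tOfSize ∣ A ∣ ℕ.+ tOfSize ∣ B ∣) 3)
      (cong (ℤ._+ + 3) (ℤP.pos-+ (tOfSize ∣ A ∣) (tOfSize ∣ B ∣))))
    (trans (ℤP.pos-+ (2 ℕ.* ∣ A ∩ B ∣) (tOfSize ∣ A ∪ B ∣))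
      (cong (ℤ._+ + tOfSize (∣ A ∪ B ∣)) (ℤP.pos-* 2 ∣ A ∩ B ∣)))
    (+≤+ (tOfSize-merge {∣ A ∣} {∣ B ∣} {∣ A ∩ B ∣} {∣ A ∪ B ∣} 3≤∣A∩B∣ (∣p∪q∣+∣p∩q∣≡∣p∣+∣q∣ A B)))

valFam-∷ : ∀ {n} (u v : Fin n) (H : Subset n) (F : List (Subset n)) →
  valFam u v (H ∷ F) ≡ val u v H ℤ.+ valFam u v F ℤ.- + 2
valFam-∷ u v H F =
  trans (cong (λ k → val u v H ℤ.+ S ℤ.- + 2 ℤ.* (k ℤ.- + 1)) (ℤP.pos-+ 1 (length F)))
        (regroup (val u v H) S (+ length F))
  where
  S : ℤ
  S = foldr ℤ._+_ (+ 0) (map (val u v) F)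
  regroup : ∀ x s k → x ℤ.+ s ℤ.- + 2 ℤ.* ((+ 1 ℤ.+ k) ℤ.- + 1) ≡ x ℤ.+ (s ℤ.- + 2 ℤ.* (k ℤ.- + 1)) ℤ.- + 2
  regroup = solve-∀

valFam-∷∷ : ∀ {n} (u v : Fin n) (H K : Subset n) (F : List (Subset n)) →
  valFam u v (H ∷ K ∷ F) ≡ val u v H ℤ.+ val u v K ℤ.+ valFam u v F ℤ.- + 4
valFam-∷∷ u v H K F = trans (valFam-∷ u v H (K ∷ F))
  (trans (cong (λ s → val u v H ℤ.+ s ℤ.- + 2) (valFam-∷ u v K F))
         (regroup (val u v H) (val u v K) (valFam u v F)))
  where
  regroup : ∀ x y f → x ℤ.+ (y ℤ.+ f ℤ.- + 2) ℤ.- + 2 ≡ x ℤ.+ y ℤ.+ f ℤ.- + 4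
  regroup = solve-∀

valFam-↭ : ∀ {n} (u v : Fin n) {F F′ : List (Subset n)} → F ↭ F′ → valFam u v F ≡ valFam u v F′
valFam-↭ u v ↭-refl = refl
valFam-↭ u v (↭-prep {xs = F} {ys = F′} H F↭F′) = begin
  valFam u v (H ∷ F)                    ≡⟨ valFam-∷ u v H F ⟩
  val u v H ℤ.+ valFam u v F ℤ.- + 2    ≡⟨ cong (λ s → val u v H ℤ.+ s ℤ.- + 2) (valFam-↭ u v F↭F′) ⟩
  val u v H ℤ.+ valFam u v F′ ℤ.- + 2   ≡⟨ valFam-∷ u v H F′ ⟨
  valFam u v (H ∷ F′)                   ∎
  where open ≡-Reasoning
valFam-↭ u v (↭-swap {xs = F} {ys = F′} H K F↭F′) = begin
  valFam u v (H ∷ K ∷ F)                             ≡⟨ valFam-∷∷ u v H K F ⟩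
  val u v H ℤ.+ val u v K ℤ.+ valFam u v F ℤ.- + 4   ≡⟨ cong₂ (λ s f → s ℤ.+ f ℤ.- + 4)
                                                          (ℤP.+-comm (val u v H) (val u v K)) (valFam-↭ u v F↭F′) ⟩
  val u v K ℤ.+ val u v H ℤ.+ valFam u v F′ ℤ.- + 4  ≡⟨ valFam-∷∷ u v K H F′ ⟨
  valFam u v (K ∷ H ∷ F′)                            ∎
  where open ≡-Reasoning
valFam-↭ u v (↭-trans F↭F′ F′↭F″) = trans (valFam-↭ u v F↭F′) (valFam-↭ u v F′↭F″)

valFam-∪-merge< : ∀ {n} (u v : Fin n) {F R : List (Subset n)} {A B : Subset n} →
  F ↭ A ∷ B ∷ R → 3 ≤ ∣ A ∩ B ∣ → valFam u v ((A ∪ B) ∷ R) < valFam u v F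
valFam-∪-merge< u v {F} {R} {A} {B} F↭ABR 3≤∣A∩B∣ = begin-strict
  valFam u v ((A ∪ B) ∷ R)                                 ≡⟨ valFam-∷ u v (A ∪ B) R ⟩
  val u v (A ∪ B) ℤ.+ valFam u v R ℤ.- + 2                 ≡⟨ regroup (val u v (A ∪ B)) (valFam u v R) ⟩
  (val u v (A ∪ B) ℤ.+ + 2) ℤ.+ (valFam u v R ℤ.- + 4)     <⟨ ℤP.+-monoˡ-< (valFam u v R ℤ.- + 4)
                                                                (val-∪+2<val+val u v A B 3≤∣A∩B∣) ⟩
  val u v A ℤ.+ val u v B ℤ.+ (valFam u v R ℤ.- + 4)       ≡⟨ ℤP.+-assoc (val u v A ℤ.+ val u v B) (valFam u v R) (ℤ.- + 4) ⟨
  val u v A ℤ.+ val u v B ℤ.+ valFam u v R ℤ.- + 4         ≡⟨ valFam-∷∷ u v A B R ⟨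
  valFam u v (A ∷ B ∷ R)                                   ≡⟨ valFam-↭ u v F↭ABR ⟨
  valFam u v F                                             ∎
  where
  open ℤP.≤-Reasoning
  regroup : ∀ x r → x ℤ.+ r ℤ.- + 2 ≡ (x ℤ.+ + 2) ℤ.+ (r ℤ.- + 4)
  regroup = solve-∀

∪-merge-compatible : ∀ {n} {u v : Fin n} {F R : List (Subset n)} {A B : Subset n} →
  Compatible u v F → F ↭ A ∷ B ∷ R → Compatible u v ((A ∪ B) ∷ R)
∪-merge-compatible {A = A} {B} (_ , compat) F↭ABR with All-resp-↭ F↭ABR compat
... | (u∈A , v∈A , 3≤∣A∣) ∷ _ ∷ compatR =
  s≤s z≤n , (SubsetP.p⊆p∪q B u∈A , SubsetP.p⊆p∪q B v∈A , ℕP.≤-trans 3≤∣A∣ (SubsetP.∣p∣≤∣p∪q∣ A B)) ∷ compatR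

∪-merge-covers : ∀ {n} {F R : List (Subset n)} {A B : Subset n} {x y} →
  F ↭ A ∷ B ∷ R → Cov F x y → Cov ((A ∪ B) ∷ R) x y
∪-merge-covers {A = A} {B} F↭ABR xy∈F with Any-resp-↭ F↭ABR xy∈F
... | here (x∈A , y∈A) = here (SubsetP.p⊆p∪q B x∈A , SubsetP.p⊆p∪q B y∈A)
... | there (here (x∈B , y∈B)) = here (SubsetP.q⊆p∪q A B x∈B , SubsetP.q⊆p∪q A B y∈B)
... | there (there xy∈R) = there xy∈R

∧-monoʳ-true : ∀ a {c d : Bool} → (c ≡ true → d ≡ true) → a ∧ c ≡ true → a ∧ d ≡ true
∧-monoʳ-true true c⇒d = c⇒d
∧-monoʳ-true false _ ()

sum-map-mono : ∀ {A : Set} (xs : List A) {f g : A → ℕ} → (∀ x → f x ≤ g x) →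
  sum (map f xs) ≤ sum (map g xs)
sum-map-mono [] f≤g = z≤n
sum-map-mono (x ∷ xs) f≤g = ℕP.+-mono-≤ (f≤g x) (sum-map-mono xs f≤g)

indicator-mono : ∀ {b c : Bool} → (b ≡ true → c ≡ true) → (if b then 1 else 0) ≤ (if c then 1 else 0)
indicator-mono {false} _ = z≤n
indicator-mono {true} b⇒c rewrite b⇒c refl = ℕP.≤-refl

pairCount-mono : ∀ {n} {P Q : Fin n → Fin n → Bool} → (∀ x y → P x y ≡ true → Q x y ≡ true) →
  pairCount P ≤ pairCount Q
pairCount-mono {n} P⇒Q = sum-map-mono (allFin n) λ x → sum-map-mono (allFin n) λ y →
  indicator-mono (∧-monoʳ-true (toℕ x ℕ.<ᵇ toℕ y) (P⇒Q x y))

covB⇒Cov : ∀ {n} (F : List (Subset n)) x y → covB F x y ≡ true → Cov F x y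
covB⇒Cov (S ∷ F) x y xy∈F with Vec.lookup S x in x∈S | Vec.lookup S y in y∈S
... | true | true = here (lookup⇒[]= x S x∈S , lookup⇒[]= y S y∈S)
... | true | false = there (covB⇒Cov F x y xy∈F)
... | false | _ = there (covB⇒Cov F x y xy∈F)

Cov⇒covB : ∀ {n} (F : List (Subset n)) x y → Cov F x y → covB F x y ≡ true
Cov⇒covB (S ∷ F) x y (here (x∈S , y∈S)) rewrite []=⇒lookup x∈S | []=⇒lookup y∈S = refl
Cov⇒covB (S ∷ F) x y (there xy∈F) rewrite Cov⇒covB F x y xy∈F = BoolP.∨-zeroʳ _

iFam-mono : ∀ {n} (G : Graph n) {F F′ : List (Subset n)} → (∀ x y → Cov F x y → Cov F′ x y) →
  iFam G F ≤ iFam G F′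
iFam-mono G {F} {F′} F⊆F′ = pairCount-mono λ x y →
  ∧-monoʳ-true (adj G x y) (Cov⇒covB F′ x y ∘ F⊆F′ x y ∘ covB⇒Cov F x y)

tight⇒∣A∩B∣≤2 : ∀ {n} {G : Graph n} {u v : Fin n} {F R : List (Subset n)} {A B : Subset n} →
  Sparse G u v → Compatible u v F → Tight G u v F → F ↭ A ∷ B ∷ R → ∣ A ∩ B ∣ ≤ 2
tight⇒∣A∩B∣≤2 {G = G} {u} {v} {F} {R} {A} {B} (_ , sparseFam) compat tight F↭ABR
  with 3 ≤? ∣ A ∩ B ∣
... | no 3≰∣A∩B∣ = ℕP.≤-pred (ℕP.≰⇒> 3≰∣A∩B∣)
... | yes 3≤∣A∩B∣ = ⊥-elim (ℤP.<-irrefl tight (begin-strict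
  + iFam G F                    ≤⟨ +≤+ (iFam-mono G (λ _ _ → ∪-merge-covers F↭ABR)) ⟩
  + iFam G ((A ∪ B) ∷ R)        ≤⟨ sparseFam _ (∪-merge-compatible compat F↭ABR) ⟩
  valFam u v ((A ∪ B) ∷ R)      <⟨ valFam-∪-merge< u v F↭ABR 3≤∣A∩B∣ ⟩
  valFam u v F                  ∎))
  where open ℤP.≤-Reasoning

uv⊆A∩B : ∀ {n} {u v : Fin n} {F R : List (Subset n)} {A B : Subset n} →
  Compatible u v F → F ↭ A ∷ B ∷ R → ⁅ u ⁆ ∪ ⁅ v ⁆ ⊆ A ∩ B
uv⊆A∩B {u = u} {v} (_ , compat) F↭ABR x∈uv with All-resp-↭ F↭ABR compat
... | (u∈A , v∈A , _) ∷ (u∈B , v∈B , _) ∷ _ with SubsetP.x∈p∪q⁻ ⁅ u ⁆ ⁅ v ⁆ x∈uv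
...   | inj₁ x∈⁅u⁆ rewrite SubsetP.x∈⁅y⁆⇒x≡y u x∈⁅u⁆ = SubsetP.x∈p∩q⁺ (u∈A , u∈B)
...   | inj₂ x∈⁅v⁆ rewrite SubsetP.x∈⁅y⁆⇒x≡y v x∈⁅v⁆ = SubsetP.x∈p∩q⁺ (v∈A , v∈B)

tight⇒A∩B≡uv : ∀ {n} {G : Graph n} {u v : Fin n} {F R : List (Subset n)} {A B : Subset n} → u ≢ v →
  Sparse G u v → Compatible u v F → Tight G u v F → F ↭ A ∷ B ∷ R → A ∩ B ≡ ⁅ u ⁆ ∪ ⁅ v ⁆
tight⇒A∩B≡uv {G = G} {u} {v} {A = A} {B} u≢v sparse compat tight F↭ABR = ≡-sym (p⊆q∧∣q∣≤∣p∣⇒p≡q uv⊆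
  (ℕP.≤-trans (tight⇒∣A∩B∣≤2 {G = G} sparse compat tight F↭ABR) (x≢y⇒1<∣p∣ u≢v u∈uv v∈uv)))
  where
  uv⊆ : ⁅ u ⁆ ∪ ⁅ v ⁆ ⊆ A ∩ B
  uv⊆ = uv⊆A∩B compat F↭ABR
  u∈uv : u ∈ ⁅ u ⁆ ∪ ⁅ v ⁆
  u∈uv = SubsetP.p⊆p∪q ⁅ v ⁆ (SubsetP.x∈⁅x⁆ u)
  v∈uv : v ∈ ⁅ u ⁆ ∪ ⁅ v ⁆
  v∈uv = SubsetP.q⊆p∪q ⁅ u ⁆ ⁅ v ⁆ (SubsetP.x∈⁅x⁆ v)

lemma3p2 : (n : ℕ) (G : Graph n) (u v : Fin n) → u ≢ v →
    (F : List (Subset n)) → Compatible u v F →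
    ((∃₂ λ (i j : Fin (length F)) →
        toℕ i <ℕ toℕ j × 3 ≤ ∣ lookup F i ∩ lookup F j ∣) →
      Σ (List (Subset n)) λ F′ → Compatible u v F′ ×
        (∀ x y → Cov F x y → Cov F′ x y) × valFam u v F′ < valFam u v F)
    ×
    (Sparse G u v → Tight G u v F →
      ∀ (i j : Fin (length F)) → toℕ i <ℕ toℕ j →
        lookup F i ∩ lookup F j ≡ ⁅ u ⁆ ∪ ⁅ v ⁆)
lemma3p2 n G u v u≢v F compat = merge , separated
  where
  merge : (∃₂ λ (i j : Fin (length F)) → toℕ i <ℕ toℕ j × 3 ≤ ∣ lookup F i ∩ lookup F j ∣) →
    Σ (List (Subset n)) λ F′ → Compatible u v F′ × (∀ x y → Cov F x y → Cov F′ x y) × valFam u v F′ < valFam u v F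
  merge (i , j , i<j , 3≤∣Hi∩Hj∣) with lookup₂-↭ F i j i<j
  ... | R , F↭ = (lookup F i ∪ lookup F j) ∷ R , ∪-merge-compatible compat F↭ ,
                 (λ _ _ → ∪-merge-covers F↭) , valFam-∪-merge< u v F↭ 3≤∣Hi∩Hj∣
  separated : Sparse G u v → Tight G u v F →
    ∀ (i j : Fin (length F)) → toℕ i <ℕ toℕ j → lookup F i ∩ lookup F j ≡ ⁅ u ⁆ ∪ ⁅ v ⁆
  separated sparse tight i j i<j = tight⇒A∩B≡uv {G = G} u≢v sparse compat tight (proj₂ (lookup₂-↭ F i j i<j))
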